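{- Let $m,n,s,k,\alpha,t$ be positive integers. If there exists an ${}^{\alpha}\mathrm{H}_t(m,n;s,k)$, then for every positive divisor $\lambda$ of $t$ there exists a ${}^{\lambda\alpha}\mathrm{H}_{t/\lambda}(m,n;s,k)$.
   Context: A partially filled (p.f.) $m\times n$ array is an $m\times n$ matrix in which some cells may be empty. For positive integers $\mu,\tau$ with $\tau$ dividing $\frac{2nk}{\mu}$, put $w=\frac{2nk}{\mu}+\tau$ and let $J$ be the subgroup of $\mathbb{Z}_w$ of order $\tau$. A $\mu$-fold Heffter array over $\mathbb{Z}_w$ relative to $J$, denoted ${}^{\mu}\mathrm{H}_\tau(m,n;s,k)$, is an $m\times n$ p.f. array with entries in $\mathbb{Z}_w$ such that: (a) each row has exactly $s$ filled cells and each column exactly $k$ filled cells; (b) the multiset $\{\pm x : x \text{ an entry of a filled cell}\}$ (with multiplicity over all filled cells) contains each element of $\mathbb{Z}_w\setminus J$ exactly $\mu$ times; (c) the entries of every row and every column sum to $0$ in $\mathbb{Z}_w$. -}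

module Defs where

open import Data.Nat using (ℕ; zero; suc; _+_; _*_; _≟_)
open import Data.Nat.Divisibility using (_∣_; _∣?_)
open import Data.Fin using (Fin; toℕ)
open import Data.List using (map; allFin)
open import Data.Nat.ListAction using (sum)
open import Data.Maybe using (Maybe; just; nothing)
open import Data.Product using (Σ; _×_)
open import Relation.Nullary.Decidable using (Dec; yes; no)
open import Relation.Binary.PropositionalEquality using (_≡_)
open import Relation.Nullary using (¬_)

sumFin : ∀ {n} → (Fin n → ℕ) → ℕ
sumFin {n} f = sum (map f (allFin n))

ind : ∀ {p} {P : Set p} → Dec P → ℕ
ind (yes _) = 1
ind (no _)  = 0

-- A partially filled m × n array with entries in Z_w (represented by Fin w);
-- nothing = empty cell.
PFArray : ℕ → ℕ → ℕ → Set
PFArray m n w = Fin m → Fin n → Maybe (Fin w)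

filled : ∀ {w} → Maybe (Fin w) → ℕ
filled (just _) = 1
filled nothing  = 0

-- Representative in {0,…,w-1} of the entry (0 for an empty cell,
-- which does not affect sums).
val : ∀ {w} → Maybe (Fin w) → ℕ
val (just e) = toℕ e
val nothing  = 0

-- Number of times x ∈ Z_w occurs in the multiset {e, -e} of a cell
-- (0 for an empty cell).  -e ≡ x in Z_w  iff  w ∣ x + e.
occ : ∀ {w : ℕ} → Fin w → Maybe (Fin w) → ℕ
occ {w} x (just e) = ind (toℕ e ≟ toℕ x) + ind (w ∣? (toℕ x + toℕ e))
occ x nothing  = 0

-- Membership in the subgroup J of Z_w of order τ (τ ∣ w):
-- J = { x : τ x ≡ 0 in Z_w }.
inJ : (w τ : ℕ) → Fin w → Set
inJ w τ x = w ∣ τ * toℕ x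

record IsHeffter (μ τ m n s k w : ℕ) (A : PFArray m n w) : Set where
  field
    rowFill : ∀ i → sumFin (λ j → filled (A i j)) ≡ s
    colFill : ∀ j → sumFin (λ i → filled (A i j)) ≡ k
    multOut : ∀ x → ¬ inJ w τ x →
              sumFin (λ i → sumFin (λ j → occ x (A i j))) ≡ μ
    multIn  : ∀ x → inJ w τ x →
              sumFin (λ i → sumFin (λ j → occ x (A i j))) ≡ 0
    rowSum  : ∀ i → w ∣ sumFin (λ j → val (A i j))
    colSum  : ∀ j → w ∣ sumFin (λ i → val (A i j))

HeffterExists : (μ τ m n s k : ℕ) → Set
HeffterExists μ τ m n s k =
  Σ ℕ λ d → (μ * d ≡ 2 * n * k) × (τ ∣ d) ×
    Σ (PFArray m n (d + τ)) (IsHeffter μ τ m n s k (d + τ))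

-- Write λ for l.  The modulus of an ^α H_t array is w₀ = d + t = λ w with w = d/λ + t/λ.
-- Reducing every entry modulo w maps Z_{λw} onto Z_w; each x ∈ Z_w has the λ preimages
-- x + r w (r < λ), and x lies in the subgroup of order t/λ iff its preimages lie in the
-- subgroup of order t.  So the multiplicity of x among the ±entries of the reduced array is
-- the sum of the multiplicities of its λ preimages in the original one, i.e. λα off the
-- subgroup and 0 on it, while the filled cells and the vanishing row and column sums survive.
module Submission where

open import Defs
open import Data.Nat using (ℕ; zero; suc; _+_; _*_; _≤_; _<_; NonZero; _≟_; s≤s; >-nonZero; >-nonZero⁻¹)
open import Data.Nat.Properties
open import Data.Nat.Divisibility
  using (_∣_; divides; _∣?_; ∣-refl; ∣m+n∣m⇒∣n; ∣m∣n⇒∣m+n; n∣m*n; m*n∣⇒n∣; *-cancelˡ-∣; *-cancelʳ-∣;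
         *-monoˡ-∣; *-monoʳ-∣; ∣⇒≤)
open import Data.Nat.DivMod
  using (_/_; _%_; m≡m%n+[m/n]*n; m%n<n; [m+kn]%n≡m%n; m<n⇒m%n≡m; m<n*o⇒m/o<n; %-congˡ)
open import Data.Nat.Tactic.RingSolver using (solve-∀)
import Data.Nat.ListAction as ListAction
open import Algebra.Properties.Semiring.Sum +-*-semiring
  using (sum-syntax; sum-cong-≗; sum-init-last; ∑-distrib-+; ∑-comm; *-distribʳ-sum)
open import Algebra.Properties.CommutativeSemigroup +-commutativeSemigroup using (xy∙z≈xz∙y)
open import Data.Fin using (Fin; toℕ; fromℕ<; inject₁; fromℕ) renaming (zero to fzero; suc to fsuc)
open import Data.Fin.Properties using (toℕ-fromℕ<; toℕ<n; toℕ-inject₁; toℕ-fromℕ)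
open import Data.List using (tabulate; allFin)
open import Data.List.Properties using (map-tabulate; map-cong)
open import Data.Maybe using (Maybe; just; nothing) renaming (map to mapMaybe)
open import Data.Product using (Σ; _,_; proj₁; proj₂)
open import Data.Empty using (⊥-elim)
open import Function using (id; _∘_; _⇔_; mk⇔; Equivalence)
open import Function.Properties.Equivalence using () renaming (trans to ⇔-trans)
open import Relation.Nullary using (¬_; Dec; yes; no)
open import Relation.Binary.PropositionalEquality
  using (_≡_; refl; sym; trans; cong; cong₂; subst; module ≡-Reasoning)

open Equivalence using (to; from)

∣n⇒∣m+n⇔∣m : ∀ {d m n} → d ∣ n → (d ∣ m + n) ⇔ (d ∣ m)
∣n⇒∣m+n⇔∣m {d} {m} {n} d∣n =
  mk⇔ (λ d∣m+n → ∣m+n∣m⇒∣n (subst (d ∣_) (+-comm m n) d∣m+n) d∣n) (λ d∣m → ∣m∣n⇒∣m+n d∣m d∣n)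

∣m+n⇔∣m+n%d : ∀ d .{{_ : NonZero d}} m n → (d ∣ m + n) ⇔ (d ∣ m + n % d)
∣m+n⇔∣m+n%d d m n = subst (λ y → (d ∣ y) ⇔ (d ∣ m + n % d)) (sym m+n≡) (∣n⇒∣m+n⇔∣m (n∣m*n (n / d)))
  where
  m+n≡ : m + n ≡ m + n % d + n / d * d
  m+n≡ = trans (cong (m +_) (m≡m%n+[m/n]*n n d)) (sym (+-assoc m (n % d) (n / d * d)))

sum-tabulate : ∀ {n} (f : Fin n → ℕ) → ListAction.sum (tabulate f) ≡ ∑[ i < n ] f i
sum-tabulate {zero}  f = refl
sum-tabulate {suc n} f = cong (f fzero +_) (sum-tabulate (f ∘ fsuc))

sumFin≡∑ : ∀ {n} (f : Fin n → ℕ) → sumFin f ≡ ∑[ i < n ] f i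
sumFin≡∑ f = trans (cong ListAction.sum (map-tabulate id f)) (sum-tabulate f)

∑-cong : ∀ {n} {f g : Fin n → ℕ} → (∀ i → f i ≡ g i) → ∑[ i < n ] f i ≡ ∑[ i < n ] g i
∑-cong = sum-cong-≗

sumFin-cong : ∀ {n} {f g : Fin n → ℕ} → (∀ i → f i ≡ g i) → sumFin f ≡ sumFin g
sumFin-cong {n} f≗g = cong ListAction.sum (map-cong f≗g (allFin n))

∑-const : ∀ n c → ∑[ i < n ] c ≡ n * c
∑-const zero    c = refl
∑-const (suc n) c = cong (c +_) (∑-const n c)

∑-zero : ∀ {n} {f : Fin n → ℕ} → (∀ i → f i ≡ 0) → ∑[ i < n ] f i ≡ 0
∑-zero {n} f≗0 = trans (∑-cong f≗0) (trans (∑-const n 0) (*-zeroʳ n))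

∑-divMod : ∀ {n} w .{{_ : NonZero w}} (f : Fin n → ℕ) →
           ∑[ j < n ] f j ≡ ∑[ j < n ] (f j % w) + (∑[ j < n ] (f j / w)) * w
∑-divMod {n} w f = begin
  ∑[ j < n ] f j                                   ≡⟨ ∑-cong (λ j → m≡m%n+[m/n]*n (f j) w) ⟩
  ∑[ j < n ] (f j % w + f j / w * w)               ≡⟨ ∑-distrib-+ (λ j → f j % w) (λ j → f j / w * w) ⟩
  ∑[ j < n ] (f j % w) + ∑[ j < n ] (f j / w * w)  ≡⟨ cong (∑[ j < n ] (f j % w) +_) (*-distribʳ-sum w (λ j → f j / w)) ⟨
  ∑[ j < n ] (f j % w) + (∑[ j < n ] (f j / w)) * w ∎
  where open ≡-Reasoning

∣∑⇒∣∑% : ∀ {n} w .{{_ : NonZero w}} (f : Fin n → ℕ) → w ∣ ∑[ j < n ] f j → w ∣ ∑[ j < n ] (f j % w)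
∣∑⇒∣∑% {n} w f w∣∑ = to (∣n⇒∣m+n⇔∣m (n∣m*n (∑[ j < n ] (f j / w)))) (subst (w ∣_) (∑-divMod w f) w∣∑)

-- Peeling the first and the last term off a sum over Fin (suc n) gives h 0 + A = B + h n.
∑-shift : ∀ n (h : ℕ → ℕ) → h n ≡ h 0 → ∑[ r < n ] h (suc (toℕ r)) ≡ ∑[ r < n ] h (toℕ r)
∑-shift n h hn≡h0 = +-cancelˡ-≡ (h 0) _ _ (begin
  ∑[ r < suc n ] h (toℕ r)                         ≡⟨ sum-init-last (h ∘ toℕ) ⟩
  ∑[ r < n ] h (toℕ (inject₁ r)) + h (toℕ (fromℕ n)) ≡⟨ cong₂ _+_ (∑-cong {n} (cong h ∘ toℕ-inject₁))
                                                                 (trans (cong h (toℕ-fromℕ n)) hn≡h0) ⟩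
  ∑[ r < n ] h (toℕ r) + h 0                       ≡⟨ +-comm _ (h 0) ⟩
  h 0 + ∑[ r < n ] h (toℕ r)                       ∎)
  where open ≡-Reasoning

∑-periodic-window : ∀ n (g : ℕ → ℕ) → (∀ y → g (y + n) ≡ g y) →
                    ∀ q → ∑[ r < n ] g (q + toℕ r) ≡ ∑[ r < n ] g (toℕ r)
∑-periodic-window n g periodic zero    = refl
∑-periodic-window n g periodic (suc q) = begin
  ∑[ r < n ] g (suc q + toℕ r)   ≡⟨ ∑-cong {n} (λ r → cong g (+-suc q (toℕ r))) ⟨
  ∑[ r < n ] g (q + suc (toℕ r)) ≡⟨ ∑-shift n (λ i → g (q + i)) (trans (periodic q) (cong g (sym (+-identityʳ q)))) ⟩
  ∑[ r < n ] g (q + toℕ r)       ≡⟨ ∑-periodic-window n g periodic q ⟩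
  ∑[ r < n ] g (toℕ r)           ∎
  where open ≡-Reasoning

ind-cong : ∀ {p q} {P : Set p} {Q : Set q} → P ⇔ Q → (P? : Dec P) (Q? : Dec Q) → ind P? ≡ ind Q?
ind-cong P⇔Q (yes _) (yes _) = refl
ind-cong P⇔Q (yes p) (no ¬q) = ⊥-elim (¬q (to P⇔Q p))
ind-cong P⇔Q (no ¬p) (yes q) = ⊥-elim (¬p (from P⇔Q q))
ind-cong P⇔Q (no _)  (no _)  = refl

ind-yes : ∀ {p} {P : Set p} → P → (P? : Dec P) → ind P? ≡ 1
ind-yes p (yes _) = refl
ind-yes p (no ¬p) = ⊥-elim (¬p p)

ind-no : ∀ {p} {P : Set p} → ¬ P → (P? : Dec P) → ind P? ≡ 0
ind-no ¬p (yes p) = ⊥-elim (¬p p)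
ind-no ¬p (no _)  = refl

∑-ind-≟ : ∀ {n} q → q < n → ∑[ r < n ] ind (q ≟ toℕ r) ≡ 1
∑-ind-≟ {suc n} zero    _          =
  cong₂ _+_ (ind-yes refl (0 ≟ 0)) (∑-zero {n} (λ r → ind-no (λ ()) (0 ≟ suc (toℕ r))))
∑-ind-≟ {suc n} (suc q) (s≤s q<n) =
  cong₂ _+_ (ind-no (λ ()) (suc q ≟ 0))
            (trans (∑-cong {n} (λ r → ind-cong (mk⇔ suc-injective (cong suc)) (suc q ≟ suc (toℕ r)) (q ≟ toℕ r)))
                   (∑-ind-≟ q q<n))

∑-ind-∣ : ∀ n .{{_ : NonZero n}} q → ∑[ r < n ] ind (n ∣? q + toℕ r) ≡ 1
∑-ind-∣ n q = trans (∑-periodic-window n (λ y → ind (n ∣? y)) periodic q) (multiplesBelow n)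
  where
  periodic : ∀ y → ind (n ∣? y + n) ≡ ind (n ∣? y)
  periodic y = ind-cong (∣n⇒∣m+n⇔∣m ∣-refl) _ _
  multiplesBelow : ∀ n .{{_ : NonZero n}} → ∑[ r < n ] ind (n ∣? toℕ r) ≡ 1
  multiplesBelow (suc n) =
    cong₂ _+_ (ind-yes (divides 0 refl) (suc n ∣? 0))
              (∑-zero {n} (λ r → ind-no (λ d → <⇒≱ (s≤s (toℕ<n r)) (∣⇒≤ d)) _))

∑-ind-≟-lift : ∀ l w .{{_ : NonZero w}} e x → e < l * w → x < w →
               ∑[ r < l ] ind (e ≟ x + toℕ r * w) ≡ ind (e % w ≟ x)
∑-ind-≟-lift l w e x e<lw x<w with e % w ≟ x
... | yes e%w≡x = trans (∑-cong {l} (λ r → ind-cong (mk⇔ lift≡⇒ ⇒lift≡) _ (e / w ≟ toℕ r)))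
                        (∑-ind-≟ {l} (e / w) (m<n*o⇒m/o<n e<lw))
  where
  e≡ : e ≡ x + e / w * w
  e≡ = trans (m≡m%n+[m/n]*n e w) (cong (_+ e / w * w) e%w≡x)
  lift≡⇒ : ∀ {r} → e ≡ x + r * w → e / w ≡ r
  lift≡⇒ {r} e≡lift = *-cancelʳ-≡ (e / w) r w (+-cancelˡ-≡ x _ _ (trans (sym e≡) e≡lift))
  ⇒lift≡ : ∀ {r} → e / w ≡ r → e ≡ x + r * w
  ⇒lift≡ refl = e≡
... | no e%w≢x = ∑-zero {l} (λ r → ind-no (λ e≡lift → e%w≢x (begin
  e % w                  ≡⟨ %-congˡ e≡lift ⟩
  (x + toℕ r * w) % w    ≡⟨ [m+kn]%n≡m%n x (toℕ r) w ⟩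
  x % w                  ≡⟨ m<n⇒m%n≡m x<w ⟩
  x                      ∎)) _)
  where open ≡-Reasoning

∑-ind-∣-lift : ∀ l w .{{_ : NonZero l}} .{{_ : NonZero w}} c →
               ∑[ r < l ] ind (l * w ∣? c + toℕ r * w) ≡ ind (w ∣? c)
∑-ind-∣-lift l w c with w ∣? c
... | yes (divides q refl) = trans (∑-cong {l} (λ r → ind-cong (lw∣⇔l∣ r) _ (l ∣? q + toℕ r))) (∑-ind-∣ l q)
  where
  lw∣⇔l∣ : ∀ r → (l * w ∣ q * w + toℕ r * w) ⇔ (l ∣ q + toℕ r)
  lw∣⇔l∣ r = mk⇔ (λ d → *-cancelʳ-∣ w (subst (l * w ∣_) (sym (*-distribʳ-+ w q (toℕ r))) d))
                 (λ d → subst (l * w ∣_) (*-distribʳ-+ w q (toℕ r)) (*-monoˡ-∣ w d))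
... | no w∤c = ∑-zero {l} (λ r → ind-no (λ d → w∤c (to (∣n⇒∣m+n⇔∣m (n∣m*n (toℕ r))) (m*n∣⇒n∣ l w d))) _)

multiplicity : ∀ {m n w} → Fin w → PFArray m n w → ℕ
multiplicity x A = sumFin (λ i → sumFin (λ j → occ x (A i j)))

multiplicity≡∑∑ : ∀ {m n w} (x : Fin w) (A : PFArray m n w) →
                  multiplicity x A ≡ ∑[ i < m ] ∑[ j < n ] occ x (A i j)
multiplicity≡∑∑ {m} {n} x A = trans (sumFin≡∑ {m} _) (∑-cong {m} (λ i → sumFin≡∑ {n} _))

module Reduction (l w : ℕ) .{{_ : NonZero l}} .{{_ : NonZero w}} where

  reduce : Fin (l * w) → Fin w
  reduce e = fromℕ< (m%n<n (toℕ e) w)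

  toℕ-reduce : ∀ e → toℕ (reduce e) ≡ toℕ e % w
  toℕ-reduce e = toℕ-fromℕ< (m%n<n (toℕ e) w)

  lift-< : (x : Fin w) (r : Fin l) → toℕ x + toℕ r * w < l * w
  lift-< x r = <-≤-trans (+-monoˡ-< (toℕ r * w) (toℕ<n x)) (*-monoˡ-≤ w (toℕ<n r))

  lift : Fin w → Fin l → Fin (l * w)
  lift x r = fromℕ< (lift-< x r)

  toℕ-lift : ∀ x r → toℕ (lift x r) ≡ toℕ x + toℕ r * w
  toℕ-lift x r = toℕ-fromℕ< (lift-< x r)

  reduceEntry : Maybe (Fin (l * w)) → Maybe (Fin w)
  reduceEntry = mapMaybe reduce

  reduceArray : ∀ {m n} → PFArray m n (l * w) → PFArray m n w
  reduceArray A i j = reduceEntry (A i j)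

  filled-reduceEntry : ∀ c → filled (reduceEntry c) ≡ filled c
  filled-reduceEntry (just _) = refl
  filled-reduceEntry nothing  = refl

  val-reduceEntry : ∀ c → val (reduceEntry c) ≡ val c % w
  val-reduceEntry (just e) = toℕ-reduce e
  val-reduceEntry nothing  = sym (m<n⇒m%n≡m (>-nonZero⁻¹ w))

  occ-lift : ∀ x r e → occ (lift x r) (just e)
             ≡ ind (toℕ e ≟ toℕ x + toℕ r * w) + ind (l * w ∣? (toℕ x + toℕ e) + toℕ r * w)
  occ-lift x r e rewrite toℕ-lift x r =
    cong (λ y → ind (toℕ e ≟ toℕ x + toℕ r * w) + ind (l * w ∣? y)) (xy∙z≈xz∙y (toℕ x) (toℕ r * w) (toℕ e))

  occ-reduceEntry : ∀ x c → occ x (reduceEntry c) ≡ ∑[ r < l ] occ (lift x r) c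
  occ-reduceEntry x nothing  = sym (∑-zero {l} (λ _ → refl))
  occ-reduceEntry x (just e) = sym (begin
    ∑[ r < l ] occ (lift x r) (just e)
      ≡⟨ ∑-cong {l} (λ r → occ-lift x r e) ⟩
    ∑[ r < l ] (ind (e′ ≟ x′ + toℕ r * w) + ind (l * w ∣? (x′ + e′) + toℕ r * w))
      ≡⟨ ∑-distrib-+ {l} (λ r → ind (e′ ≟ x′ + toℕ r * w)) (λ r → ind (l * w ∣? (x′ + e′) + toℕ r * w)) ⟩
    ∑[ r < l ] ind (e′ ≟ x′ + toℕ r * w) + ∑[ r < l ] ind (l * w ∣? (x′ + e′) + toℕ r * w)
      ≡⟨ cong₂ _+_ (∑-ind-≟-lift l w e′ x′ (toℕ<n e) (toℕ<n x)) (∑-ind-∣-lift l w (x′ + e′)) ⟩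
    ind (e′ % w ≟ x′) + ind (w ∣? x′ + e′)
      ≡⟨ cong (ind (e′ % w ≟ x′) +_) (ind-cong (∣m+n⇔∣m+n%d w x′ e′) _ _) ⟩
    ind (e′ % w ≟ x′) + ind (w ∣? x′ + e′ % w)
      ≡⟨ cong (λ y → ind (y ≟ x′) + ind (w ∣? x′ + y)) (toℕ-reduce e) ⟨
    occ x (just (reduce e)) ∎)
    where
    open ≡-Reasoning
    e′ = toℕ e
    x′ = toℕ x

  inJ-lift : ∀ τ x r → inJ (l * w) (l * τ) (lift x r) ⇔ inJ w τ x
  inJ-lift τ x r = subst (λ y → (l * w ∣ y) ⇔ inJ w τ x) (sym expand)
    (⇔-trans (∣n⇒∣m+n⇔∣m (n∣m*n (τ * toℕ r))) (mk⇔ (*-cancelˡ-∣ l) (*-monoʳ-∣ l)))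
    where
    expand : l * τ * toℕ (lift x r) ≡ l * (τ * toℕ x) + τ * toℕ r * (l * w)
    expand = trans (cong (l * τ *_) (toℕ-lift x r)) (distribute l τ (toℕ x) (toℕ r) w)
      where
      distribute : ∀ l τ x r w → l * τ * (x + r * w) ≡ l * (τ * x) + τ * r * (l * w)
      distribute = solve-∀

  multiplicity-reduceArray : ∀ {m n} (A : PFArray m n (l * w)) x →
                             multiplicity x (reduceArray A) ≡ ∑[ r < l ] multiplicity (lift x r) A
  multiplicity-reduceArray {m} {n} A x = begin
    multiplicity x (reduceArray A)                         ≡⟨ multiplicity≡∑∑ x (reduceArray A) ⟩
    ∑[ i < m ] ∑[ j < n ] occ x (reduceEntry (A i j))      ≡⟨ ∑-cong {m} (λ i → ∑-cong {n} (λ j → occ-reduceEntry x (A i j))) ⟩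
    ∑[ i < m ] ∑[ j < n ] ∑[ r < l ] occ (lift x r) (A i j) ≡⟨ ∑-cong {m} (λ i → ∑-comm (λ j r → occ (lift x r) (A i j))) ⟩
    ∑[ i < m ] ∑[ r < l ] ∑[ j < n ] occ (lift x r) (A i j) ≡⟨ ∑-comm (λ i r → ∑[ j < n ] occ (lift x r) (A i j)) ⟩
    ∑[ r < l ] ∑[ i < m ] ∑[ j < n ] occ (lift x r) (A i j) ≡⟨ ∑-cong {l} (λ r → multiplicity≡∑∑ (lift x r) A) ⟨
    ∑[ r < l ] multiplicity (lift x r) A                   ∎
    where open ≡-Reasoning

  ∣sumFin-val-reduceEntry : ∀ {n} (c : Fin n → Maybe (Fin (l * w))) →
                            l * w ∣ sumFin (λ j → val (c j)) → w ∣ sumFin (λ j → val (reduceEntry (c j)))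
  ∣sumFin-val-reduceEntry {n} c lw∣ =
    subst (w ∣_) (trans (∑-cong {n} (sym ∘ val-reduceEntry ∘ c)) (sym (sumFin≡∑ (val ∘ reduceEntry ∘ c))))
      (∣∑⇒∣∑% w (val ∘ c) (subst (w ∣_) (sumFin≡∑ (val ∘ c)) (m*n∣⇒n∣ l w lw∣)))

  isHeffter-reduceArray : ∀ {μ τ m n s k} (A : PFArray m n (l * w)) →
                          IsHeffter μ (l * τ) m n s k (l * w) A →
                          IsHeffter (l * μ) τ m n s k w (reduceArray A)
  isHeffter-reduceArray {μ} {τ} A H = record
    { rowFill = λ i → trans (sumFin-cong (λ j → filled-reduceEntry (A i j))) (rowFill i)
    ; colFill = λ j → trans (sumFin-cong (λ i → filled-reduceEntry (A i j))) (colFill j)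
    ; multOut = λ x x∉J → trans (multiplicity-reduceArray A x)
        (trans (∑-cong {l} (λ r → multOut (lift x r) (x∉J ∘ to (inJ-lift τ x r)))) (∑-const l μ))
    ; multIn  = λ x x∈J → trans (multiplicity-reduceArray A x)
        (∑-zero {l} (λ r → multIn (lift x r) (from (inJ-lift τ x r) x∈J)))
    ; rowSum  = λ i → ∣sumFin-val-reduceEntry (A i) (rowSum i)
    ; colSum  = λ j → ∣sumFin-val-reduceEntry (λ i → A i j) (colSum j)
    }
    where open IsHeffter H

heffterExists-coarsen : ∀ {μ m n s k} l τ .{{_ : NonZero l}} .{{_ : NonZero τ}} →
                        HeffterExists μ (l * τ) m n s k → HeffterExists (l * μ) τ m n s k
heffterExists-coarsen {μ} {m} {n} {s} {k} l τ (.(q * (l * τ)) , μd≡2nk , divides q refl , A , H) =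
  q * τ , lμ[qτ]≡2nk , n∣m*n q , reduceArray (proj₁ A′) , isHeffter-reduceArray (proj₁ A′) (proj₂ A′)
  where
  instance
    w≢0 : NonZero (q * τ + τ)
    w≢0 = >-nonZero (≤-trans (>-nonZero⁻¹ τ) (m≤n+m τ (q * τ)))
  open Reduction l (q * τ + τ)
  modulus≡ : ∀ q l τ → q * (l * τ) + l * τ ≡ l * (q * τ + τ)
  modulus≡ = solve-∀
  A′ : Σ (PFArray m n (l * (q * τ + τ))) (IsHeffter μ (l * τ) m n s k (l * (q * τ + τ)))
  A′ = subst (λ w₀ → Σ (PFArray m n w₀) (IsHeffter μ (l * τ) m n s k w₀)) (modulus≡ q l τ) (A , H)
  lμ[qτ]≡2nk : l * μ * (q * τ) ≡ 2 * n * k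
  lμ[qτ]≡2nk = trans (rearrange l μ q τ) μd≡2nk
    where
    rearrange : ∀ l μ q τ → l * μ * (q * τ) ≡ μ * (q * (l * τ))
    rearrange = solve-∀

theorem4p4 : (m n s k α t : ℕ) → 1 ≤ m → 1 ≤ n → 1 ≤ s → 1 ≤ k → 1 ≤ α → 1 ≤ t →
    HeffterExists α t m n s k →
    (l t′ : ℕ) → l * t′ ≡ t →
    HeffterExists (l * α) t′ m n s k
theorem4p4 m n s k α .(l * t′) _ _ _ _ _ 1≤t H l t′ refl =
  heffterExists-coarsen l t′ {{m*n≢0⇒m≢0 l}} {{m*n≢0⇒n≢0 l}} H
  where
  instance
    lt′≢0 : NonZero (l * t′)
    lt′≢0 = >-nonZero 1≤t
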